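{- Assume that for every object $X$ of $\mathbf{C}$ a free uniform-iteration algebra $KX$ exists and is stable. For every $f\colon X\to KY+X$, $f^\dagger\colon X\to KY$ is the least pre-fixpoint, with respect to $\sqsubseteq$, of the map $g\mapsto[\mathrm{id},g]\circ f$ on $\mathbf{C}(X,KY)$; that is, $[\mathrm{id},f^\dagger]f\sqsubseteq f^\dagger$, and $[\mathrm{id},g]f\sqsubseteq g$ implies $f^\dagger\sqsubseteq g$.
   Context: $\mathbf{C}$ is an extensive category with finite products, a stable natural number object and exponentials $X^{\mathbb{N}}$. A uniform-iteration algebra is an object $A$ with an operator $f\mapsto f^\dagger$ ($f\colon Z\to A+Z$, $f^\dagger\colon Z\to A$) satisfying (Fixpoint) $f^\dagger=[\mathrm{id},f^\dagger]f$ and (Uniformity) $(\mathrm{id}+h)f=gh\Rightarrow f^\dagger=g^\dagger h$; morphisms $h$ satisfy $hf^\dagger=((h+\mathrm{id})f)^\dagger$. $KX$ with unit $\eta$ is free on $X$; $KY$ is stable if for every $X$, $\mathrm{fst}\colon X\times KY\to X$ with $\mathrm{id}\times\eta$ is a free uniform-iteration algebra over $\mathrm{fst}\colon X\times Y\to X$ in $\mathbf{C}/X$. $\mathbb{K}$ has unit $\eta$ and Kleisli lifting $f^*$ the unique algebra morphism with $f^*\eta=f$; strength $\tau$ is the unique morphism with $\tau(\mathrm{id}\times\eta)=\eta$ and $\tau(\mathrm{id}\times h^\dagger)=((\tau+\mathrm{id})\mathrm{dstr}(\mathrm{id}\times h))^\dagger$. For $f\colon X\to KY$, $g\colon X\to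 KZ$: $f\downharpoonright g=\mathrm{fst}^*\tau\langle f,g\rangle$; for $f,f'\colon X\to KY$, $f\sqsubseteq f'$ iff $f=f'\downharpoonright f$. -}

module Defs where

open import Level using (Level; _⊔_; suc)
open import Relation.Binary.PropositionalEquality using (_≡_)
open import Data.Product using (Σ; _×_; _,_)

record Category (o h : Level) : Set (suc (o ⊔ h)) where
  infixr 9 _∘_
  field
    Obj : Set o
    Hom : Obj → Obj → Set h
    id  : ∀ {A} → Hom A A
    _∘_ : ∀ {A B C} → Hom B C → Hom A B → Hom A C
    identityˡ : ∀ {A B} {f : Hom A B} → id ∘ f ≡ f
    identityʳ : ∀ {A B} {f : Hom A B} → f ∘ id ≡ f
    assoc : ∀ {A B C D} {f : Hom C D} {g : Hom B C} {k : Hom A B} →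
            (f ∘ g) ∘ k ≡ f ∘ (g ∘ k)

module _ {o h : Level} (C : Category o h) where
  open Category C

  record Terminal : Set (o ⊔ h) where
    field
      ⊤ : Obj
      ! : ∀ {A} → Hom A ⊤
      !-unique : ∀ {A} (g : Hom A ⊤) → g ≡ !

  record Initial : Set (o ⊔ h) where
    field
      ⊥ : Obj
      ¡ : ∀ {A} → Hom ⊥ A
      ¡-unique : ∀ {A} (g : Hom ⊥ A) → g ≡ ¡

  record IsProduct {A B P : Obj} (p₁ : Hom P A) (p₂ : Hom P B) : Set (o ⊔ h) where
    field
      pair : ∀ {Z} → Hom Z A → Hom Z B → Hom Z P
      β₁ : ∀ {Z} {f : Hom Z A} {g : Hom Z B} → p₁ ∘ pair f g ≡ f
      β₂ : ∀ {Z} {f : Hom Z A} {g : Hom Z B} → p₂ ∘ pair f g ≡ g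
      unique : ∀ {Z} {f : Hom Z A} {g : Hom Z B} (k : Hom Z P) →
               p₁ ∘ k ≡ f → p₂ ∘ k ≡ g → k ≡ pair f g

  record IsCoproduct {A B S : Obj} (i₁ : Hom A S) (i₂ : Hom B S) : Set (o ⊔ h) where
    field
      copair : ∀ {Z} → Hom A Z → Hom B Z → Hom S Z
      β₁ : ∀ {Z} {f : Hom A Z} {g : Hom B Z} → copair f g ∘ i₁ ≡ f
      β₂ : ∀ {Z} {f : Hom A Z} {g : Hom B Z} → copair f g ∘ i₂ ≡ g
      unique : ∀ {Z} {f : Hom A Z} {g : Hom B Z} (k : Hom S Z) →
               k ∘ i₁ ≡ f → k ∘ i₂ ≡ g → k ≡ copair f g

  record IsPullback {P A B D : Obj} (f : Hom A D) (g : Hom B D)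
                    (p : Hom P A) (q : Hom P B) : Set (o ⊔ h) where
    field
      commute : f ∘ p ≡ g ∘ q
      universal : ∀ {Z} (u : Hom Z A) (v : Hom Z B) → f ∘ u ≡ g ∘ v → Hom Z P
      β₁ : ∀ {Z} {u : Hom Z A} {v : Hom Z B} {e : f ∘ u ≡ g ∘ v} →
           p ∘ universal u v e ≡ u
      β₂ : ∀ {Z} {u : Hom Z A} {v : Hom Z B} {e : f ∘ u ≡ g ∘ v} →
           q ∘ universal u v e ≡ v
      unique : ∀ {Z} {u : Hom Z A} {v : Hom Z B} {e : f ∘ u ≡ g ∘ v}
               (k : Hom Z P) → p ∘ k ≡ u → q ∘ k ≡ v → k ≡ universal u v e

  record BinaryProducts : Set (o ⊔ h) where
    infixr 7 _⊗_
    field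
      _⊗_ : Obj → Obj → Obj
      π₁ : ∀ {A B} → Hom (A ⊗ B) A
      π₂ : ∀ {A B} → Hom (A ⊗ B) B
      isProduct : ∀ {A B} → IsProduct (π₁ {A} {B}) (π₂ {A} {B})
    ⟨_,_⟩ : ∀ {Z A B} → Hom Z A → Hom Z B → Hom Z (A ⊗ B)
    ⟨ f , g ⟩ = IsProduct.pair isProduct f g
    infixr 8 _⊗₁_
    _⊗₁_ : ∀ {A B A' B'} → Hom A A' → Hom B B' → Hom (A ⊗ B) (A' ⊗ B')
    f ⊗₁ g = ⟨ f ∘ π₁ , g ∘ π₂ ⟩

  record BinaryCoproducts : Set (o ⊔ h) where
    infixr 6 _⊕_
    field
      _⊕_ : Obj → Obj → Obj
      inl : ∀ {A B} → Hom A (A ⊕ B)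
      inr : ∀ {A B} → Hom B (A ⊕ B)
      isCoproduct : ∀ {A B} → IsCoproduct (inl {A} {B}) (inr {A} {B})
    [_,_] : ∀ {A B Z} → Hom A Z → Hom B Z → Hom (A ⊕ B) Z
    [ f , g ] = IsCoproduct.copair isCoproduct f g
    infixr 7 _⊕₁_
    _⊕₁_ : ∀ {A B A' B'} → Hom A A' → Hom B B' → Hom (A ⊕ B) (A' ⊕ B')
    f ⊕₁ g = [ inl ∘ f , inr ∘ g ]

  -- Extensivity (Carboni–Lack–Walters): finite coproducts, pullbacks
  -- along coproduct injections exist, and in every commutative diagram
  --     X --i--> Z <--j-- Y
  --     |a       |k       |b
  --     A -inl-> A+B <-inr- B
  -- the top row is a coproduct iff both squares are pullbacks.

  module _ (I : Initial) (S : BinaryCoproducts) where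
    open BinaryCoproducts S

    record Extensive : Set (o ⊔ h) where
      field
        pullback-inl : ∀ {A B Z} (k : Hom Z (A ⊕ B)) →
          Σ Obj λ P → Σ (Hom P Z) λ p → Σ (Hom P A) λ q → IsPullback k inl p q
        pullback-inr : ∀ {A B Z} (k : Hom Z (A ⊕ B)) →
          Σ Obj λ P → Σ (Hom P Z) λ p → Σ (Hom P B) λ q → IsPullback k inr p q
        coproduct⇒pullbacks :
          ∀ {A B X Y Z} {i : Hom X Z} {j : Hom Y Z} {k : Hom Z (A ⊕ B)}
            {a : Hom X A} {b : Hom Y B} →
          k ∘ i ≡ inl ∘ a → k ∘ j ≡ inr ∘ b →
          IsCoproduct i j → IsPullback k inl i a × IsPullback k inr j b
        pullbacks⇒coproduct :
          ∀ {A B X Y Z} {i : Hom X Z} {j : Hom Y Z} {k : Hom Z (A ⊕ B)}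
            {a : Hom X A} {b : Hom Y B} →
          IsPullback k inl i a → IsPullback k inr j b → IsCoproduct i j

  -- Stable natural number object: for every X, π₁ : X × N → X (with
  -- ⟨id , zero ∘ !⟩ and id × succ) is a natural number object in C/X.

  module _ (T : Terminal) (P : BinaryProducts) where
    open Terminal T
    open BinaryProducts P

    record StableNNO : Set (o ⊔ h) where
      field
        N : Obj
        zero : Hom ⊤ N
        succ : Hom N N
        rec : ∀ {X A} (p : Hom A X) (a : Hom X A) (s : Hom A A) →
              p ∘ a ≡ id → p ∘ s ≡ p → Hom (X ⊗ N) A
        rec-over : ∀ {X A} {p : Hom A X} {a : Hom X A} {s : Hom A A}
                   {e₁ : p ∘ a ≡ id} {e₂ : p ∘ s ≡ p} →
                   p ∘ rec p a s e₁ e₂ ≡ π₁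
        rec-zero : ∀ {X A} {p : Hom A X} {a : Hom X A} {s : Hom A A}
                   {e₁ : p ∘ a ≡ id} {e₂ : p ∘ s ≡ p} →
                   rec p a s e₁ e₂ ∘ ⟨ id , zero ∘ ! ⟩ ≡ a
        rec-succ : ∀ {X A} {p : Hom A X} {a : Hom X A} {s : Hom A A}
                   {e₁ : p ∘ a ≡ id} {e₂ : p ∘ s ≡ p} →
                   rec p a s e₁ e₂ ∘ (id ⊗₁ succ) ≡ s ∘ rec p a s e₁ e₂
        rec-unique : ∀ {X A} {p : Hom A X} {a : Hom X A} {s : Hom A A}
                     {e₁ : p ∘ a ≡ id} {e₂ : p ∘ s ≡ p} (k : Hom (X ⊗ N) A) →
                     p ∘ k ≡ π₁ → k ∘ ⟨ id , zero ∘ ! ⟩ ≡ a →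
                     k ∘ (id ⊗₁ succ) ≡ s ∘ k → k ≡ rec p a s e₁ e₂

  module _ (P : BinaryProducts) (N : Obj) where
    open BinaryProducts P

    record ExponentialsBy : Set (o ⊔ h) where
      field
        _^N : Obj → Obj
        ev : ∀ {A} → Hom ((A ^N) ⊗ N) A
        curry : ∀ {Z A} → Hom (Z ⊗ N) A → Hom Z (A ^N)
        β : ∀ {Z A} {f : Hom (Z ⊗ N) A} → ev ∘ (curry f ⊗₁ id) ≡ f
        unique : ∀ {Z A} {f : Hom (Z ⊗ N) A} (k : Hom Z (A ^N)) →
                 ev ∘ (k ⊗₁ id) ≡ f → k ≡ curry f

  module _ (S : BinaryCoproducts) where
    open BinaryCoproducts S

    record UIAlg (A : Obj) : Set (o ⊔ h) where
      field
        _† : ∀ {Z} → Hom Z (A ⊕ Z) → Hom Z A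
        fixpoint : ∀ {Z} {f : Hom Z (A ⊕ Z)} → f † ≡ [ id , f † ] ∘ f
        uniformity : ∀ {Z W} {f : Hom Z (A ⊕ Z)} {g : Hom W (A ⊕ W)}
                     (k : Hom Z W) → (id ⊕₁ k) ∘ f ≡ g ∘ k → f † ≡ (g †) ∘ k

    IsUIMorphism : ∀ {A B} → UIAlg A → UIAlg B → Hom A B → Set (o ⊔ h)
    IsUIMorphism {A} {B} α β k =
      ∀ {Z} (f : Hom Z (A ⊕ Z)) →
        k ∘ UIAlg._† α f ≡ UIAlg._† β ((k ⊕₁ id) ∘ f)

    record FreeUIAlg (X : Obj) : Set (o ⊔ h) where
      field
        KX : Obj
        η : Hom X KX
        alg : UIAlg KX
        lift : ∀ {B} (β : UIAlg B) → Hom X B → Hom KX B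
        lift-morphism : ∀ {B} (β : UIAlg B) (f : Hom X B) →
                        IsUIMorphism alg β (lift β f)
        lift-η : ∀ {B} (β : UIAlg B) (f : Hom X B) → lift β f ∘ η ≡ f
        lift-unique : ∀ {B} (β : UIAlg B) (f : Hom X B) (k : Hom KX B) →
                      IsUIMorphism alg β k → k ∘ η ≡ f → k ≡ lift β f

    -- Uniform-iteration algebras in the slice C/X.  An object of C/X is
    -- p : A → X; the coproduct of (A,p) and (Z,r) is [p , r] : A+Z → X.
    record SliceUIAlg {X A : Obj} (p : Hom A X) : Set (o ⊔ h) where
      field
        dagger : ∀ {Z} {r : Hom Z X} (f : Hom Z (A ⊕ Z)) →
                 [ p , r ] ∘ f ≡ r → Hom Z A
        over : ∀ {Z} {r : Hom Z X} {f : Hom Z (A ⊕ Z)} {e : [ p , r ] ∘ f ≡ r} →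
               p ∘ dagger f e ≡ r
        fixpoint : ∀ {Z} {r : Hom Z X} {f : Hom Z (A ⊕ Z)} {e : [ p , r ] ∘ f ≡ r} →
                   dagger f e ≡ [ id , dagger f e ] ∘ f
        uniformity : ∀ {Z W} {r : Hom Z X} {s : Hom W X}
                     {f : Hom Z (A ⊕ Z)} {g : Hom W (A ⊕ W)}
                     {e : [ p , r ] ∘ f ≡ r} {e' : [ p , s ] ∘ g ≡ s}
                     (k : Hom Z W) → s ∘ k ≡ r →
                     (id ⊕₁ k) ∘ f ≡ g ∘ k → dagger f e ≡ dagger g e' ∘ k

    -- Stability of a free algebra KY: for every X, π₁ : X × KY → X with
    -- id × η is a free uniform-iteration algebra over π₁ : X × Y → X in
    -- C/X.  The algebra structure on (X × KY , π₁) is the one obtained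
    -- by pulling back KY along X → 1:  for f : Z → X × KY + Z over r,
    -- f‡ = ⟨ r , ((π₂ + id) ∘ f)† ⟩.

    module _ (P : BinaryProducts) where
      open BinaryProducts P

      module _ {Y : Obj} (F : FreeUIAlg Y) where
        open FreeUIAlg F

        stableDagger : ∀ {X Z} (r : Hom Z X) → Hom Z ((X ⊗ KX) ⊕ Z) → Hom Z (X ⊗ KX)
        stableDagger r f = ⟨ r , UIAlg._† alg ((π₂ ⊕₁ id) ∘ f) ⟩

        record Stable : Set (o ⊔ h) where
          field
            slift : ∀ {X B} {q : Hom B X} (β : SliceUIAlg q)
                    (g : Hom (X ⊗ Y) B) → q ∘ g ≡ π₁ → Hom (X ⊗ KX) B
            slift-over : ∀ {X B} {q : Hom B X} (β : SliceUIAlg q)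
                    (g : Hom (X ⊗ Y) B) (e : q ∘ g ≡ π₁) → q ∘ slift β g e ≡ π₁
            slift-morphism : ∀ {X B} {q : Hom B X} (β : SliceUIAlg q)
                    (g : Hom (X ⊗ Y) B) (e : q ∘ g ≡ π₁)
                    {Z} {r : Hom Z X} (f : Hom Z ((X ⊗ KX) ⊕ Z))
                    (e₁ : [ π₁ , r ] ∘ f ≡ r)
                    (e₂ : [ q , r ] ∘ ((slift β g e ⊕₁ id) ∘ f) ≡ r) →
                    slift β g e ∘ stableDagger r f
                      ≡ SliceUIAlg.dagger β ((slift β g e ⊕₁ id) ∘ f) e₂
            slift-η : ∀ {X B} {q : Hom B X} (β : SliceUIAlg q)
                    (g : Hom (X ⊗ Y) B) (e : q ∘ g ≡ π₁) →
                    slift β g e ∘ (id ⊗₁ η) ≡ g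
            slift-unique : ∀ {X B} {q : Hom B X} (β : SliceUIAlg q)
                    (g : Hom (X ⊗ Y) B) (e : q ∘ g ≡ π₁) (k : Hom (X ⊗ KX) B) →
                    q ∘ k ≡ π₁ →
                    (∀ {Z} {r : Hom Z X} (f : Hom Z ((X ⊗ KX) ⊕ Z))
                       (e₁ : [ π₁ , r ] ∘ f ≡ r)
                       (e₂ : [ q , r ] ∘ ((k ⊕₁ id) ∘ f) ≡ r) →
                       k ∘ stableDagger r f
                         ≡ SliceUIAlg.dagger β ((k ⊕₁ id) ∘ f) e₂) →
                    k ∘ (id ⊗₁ η) ≡ g → k ≡ slift β g e

record Setting (o h : Level) : Set (suc (o ⊔ h)) where
  field
    C : Category o h
  open Category C
  field
    terminal : Terminal C
    initial : Initial C
    products : BinaryProducts C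
    coproducts : BinaryCoproducts C
    extensive : Extensive C initial coproducts
    nno : StableNNO C terminal products
    exponentials : ExponentialsBy C products (StableNNO.N nno)
    free : (X : Obj) → FreeUIAlg C coproducts X
    stable : (X : Obj) → Stable C coproducts products (free X)
  open BinaryProducts products
  open BinaryCoproducts coproducts
  K : Obj → Obj
  K X = FreeUIAlg.KX (free X)
  η : ∀ {X} → Hom X (K X)
  η {X} = FreeUIAlg.η (free X)
  infix 10 _†
  _† : ∀ {X Z} → Hom Z (K X ⊕ Z) → Hom Z (K X)
  _† {X} f = UIAlg._† (FreeUIAlg.alg (free X)) f
  _* : ∀ {X Y} → Hom X (K Y) → Hom (K X) (K Y)
  _* {X} {Y} f = FreeUIAlg.lift (free X) (FreeUIAlg.alg (free Y)) f
  -- distributivity isomorphism  X × (A + B) ≅ X × A + X × B  (exists by extensivity)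
  field
    dstr : ∀ {X A B} → Hom (X ⊗ (A ⊕ B)) ((X ⊗ A) ⊕ (X ⊗ B))
    dstr-inverseˡ : ∀ {X A B} → [ id ⊗₁ inl , id ⊗₁ inr ] ∘ dstr {X} {A} {B} ≡ id
    dstr-inverseʳ : ∀ {X A B} → dstr {X} {A} {B} ∘ [ id ⊗₁ inl , id ⊗₁ inr ] ≡ id
  field
    τ : ∀ {X Y} → Hom (X ⊗ K Y) (K (X ⊗ Y))
    τ-η : ∀ {X Y} → τ {X} {Y} ∘ (id ⊗₁ η) ≡ η
    τ-† : ∀ {X Y Z} (k : Hom Z (K Y ⊕ Z)) →
          τ ∘ (id ⊗₁ (k †)) ≡ (((τ ⊕₁ id) ∘ dstr ∘ (id {X} ⊗₁ k)) †)
    τ-unique : ∀ {X Y} (σ : Hom (X ⊗ K Y) (K (X ⊗ Y))) →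
          σ ∘ (id ⊗₁ η) ≡ η →
          (∀ {Z} (k : Hom Z (K Y ⊕ Z)) →
             σ ∘ (id ⊗₁ (k †)) ≡ (((σ ⊕₁ id) ∘ dstr ∘ (id {X} ⊗₁ k)) †)) →
          σ ≡ τ
  infix 5 _⇂_
  _⇂_ : ∀ {X Y Z} → Hom X (K Y) → Hom X (K Z) → Hom X (K Y)
  f ⇂ g = (π₁ *) ∘ τ ∘ ⟨ f , g ⟩
  infix 4 _⊑_
  _⊑_ : ∀ {X Y} → Hom X (K Y) → Hom X (K Y) → Set h
  f ⊑ f' = f ≡ (f' ⇂ f)

-- Write a ⇂ b for restrict ∘ ⟨ a , b ⟩, where restrict = π₁* ∘ τ.  By stability, a map
-- P × KY → B that commutes with iteration in its KY argument is determined by its restriction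
-- along id × η; hence ⇂ is idempotent and associative.  Idempotence makes ⊑ reflexive, which
-- together with the fixpoint law is the first claim.
-- For leastness let G = [ id , g ] ∘ f, so that G = g ⇂ G.  On KY × X the iteration body
-- F (a , x) = a ⇂ f x (continuing with (a , x') when f x = inr x') has F† (a , x) = a ⇂ f† x.
-- The body H that carries a ⇂ G x instead satisfies H = (id + k) F and H k = H for the
-- idempotent k (a , x) = (a ⇂ g x , x), and at (g x , x) it is just f.  Two applications of
-- uniformity give f† = H† ⟨ g , id ⟩ = F† ⟨ g , id ⟩ = g ⇂ f†.
module Submission where

open import Level using (_⊔_)
open import Data.Product using (_×_; _,_)
open import Relation.Binary.PropositionalEquality
  using (_≡_; refl; sym; trans; cong; cong₂; module ≡-Reasoning)

open import Defs

module CategoryLaws {o h} (C : Category o h) where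
  open Category C

  private variable
    a b c f f' g g' : Hom _ _

  ∘-congˡ : f ≡ f' → f ∘ g ≡ f' ∘ g
  ∘-congˡ {g = g} = cong (_∘ g)

  ∘-congʳ : g ≡ g' → f ∘ g ≡ f ∘ g'
  ∘-congʳ {f = f} = cong (f ∘_)

  pullˡ : a ∘ b ≡ c → a ∘ (b ∘ f) ≡ c ∘ f
  pullˡ e = trans (sym assoc) (∘-congˡ e)

  pullʳ : a ∘ b ≡ c → (f ∘ a) ∘ b ≡ f ∘ c
  pullʳ e = trans assoc (∘-congʳ e)

module ProductLaws {o h} {C : Category o h} (P : BinaryProducts C) where
  open Category C
  open BinaryProducts P
  open CategoryLaws C

  private variable
    a b f f' g g' k : Hom _ _

  project₁ : π₁ ∘ ⟨ f , g ⟩ ≡ f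
  project₁ = IsProduct.β₁ isProduct

  project₂ : π₂ ∘ ⟨ f , g ⟩ ≡ g
  project₂ = IsProduct.β₂ isProduct

  ⟨⟩-η : ⟨ π₁ ∘ k , π₂ ∘ k ⟩ ≡ k
  ⟨⟩-η {k = k} = sym (IsProduct.unique isProduct k refl refl)

  ⟨⟩-cong₂ : f ≡ f' → g ≡ g' → ⟨ f , g ⟩ ≡ ⟨ f' , g' ⟩
  ⟨⟩-cong₂ = cong₂ ⟨_,_⟩

  ⟨⟩∘ : ⟨ f , g ⟩ ∘ k ≡ ⟨ f ∘ k , g ∘ k ⟩
  ⟨⟩∘ = IsProduct.unique isProduct _ (pullˡ project₁) (pullˡ project₂)

  ⊗₁∘⟨⟩ : (f ⊗₁ g) ∘ ⟨ a , b ⟩ ≡ ⟨ f ∘ a , g ∘ b ⟩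
  ⊗₁∘⟨⟩ = trans ⟨⟩∘ (⟨⟩-cong₂ (pullʳ project₁) (pullʳ project₂))

  ⊗₁∘⊗₁ : (f ⊗₁ g) ∘ (a ⊗₁ b) ≡ (f ∘ a) ⊗₁ (g ∘ b)
  ⊗₁∘⊗₁ = trans ⊗₁∘⟨⟩ (⟨⟩-cong₂ (sym assoc) (sym assoc))

  ⊗₁-id : ∀ {A B} → id {A} ⊗₁ id {B} ≡ id
  ⊗₁-id = trans (⟨⟩-cong₂ (trans identityˡ (sym identityʳ)) (trans identityˡ (sym identityʳ))) ⟨⟩-η

  id⊗₁∘⟨⟩ : (id ⊗₁ f) ∘ ⟨ a , b ⟩ ≡ ⟨ a , f ∘ b ⟩
  id⊗₁∘⟨⟩ = trans ⊗₁∘⟨⟩ (⟨⟩-cong₂ identityˡ refl)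

  id⊗₁∘⟨_,id⟩ : ∀ {A B Z} {f : Hom Z B} (a : Hom Z A) → (id ⊗₁ f) ∘ ⟨ a , id ⟩ ≡ ⟨ a , f ⟩
  id⊗₁∘⟨ a ,id⟩ = trans id⊗₁∘⟨⟩ (⟨⟩-cong₂ refl identityʳ)

  ⟨π₁,π₂⟩ : ∀ {A B} → ⟨ π₁ {A} {B} , π₂ ⟩ ≡ id
  ⟨π₁,π₂⟩ = trans (⟨⟩-cong₂ (sym identityʳ) (sym identityʳ)) ⟨⟩-η

  π₁∘id⊗₁ : ∀ {A} → π₁ ∘ (id {A} ⊗₁ f) ≡ π₁
  π₁∘id⊗₁ = trans project₁ identityˡ

module CoproductLaws {o h} {C : Category o h} (S : BinaryCoproducts C) where
  open Category C
  open BinaryCoproducts S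
  open CategoryLaws C

  private variable
    a b f f' g g' k : Hom _ _

  inject₁ : [ f , g ] ∘ inl ≡ f
  inject₁ = IsCoproduct.β₁ isCoproduct

  inject₂ : [ f , g ] ∘ inr ≡ g
  inject₂ = IsCoproduct.β₂ isCoproduct

  []-cong₂ : f ≡ f' → g ≡ g' → [ f , g ] ≡ [ f' , g' ]
  []-cong₂ = cong₂ [_,_]

  ∘[] : k ∘ [ f , g ] ≡ [ k ∘ f , k ∘ g ]
  ∘[] = IsCoproduct.unique isCoproduct _ (pullʳ inject₁) (pullʳ inject₂)

  []∘⊕₁ : [ f , g ] ∘ (a ⊕₁ b) ≡ [ f ∘ a , g ∘ b ]
  []∘⊕₁ = trans ∘[] ([]-cong₂ (pullˡ inject₁) (pullˡ inject₂))

  ⊕₁∘⊕₁ : (f ⊕₁ g) ∘ (a ⊕₁ b) ≡ (f ∘ a) ⊕₁ (g ∘ b)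
  ⊕₁∘⊕₁ = trans []∘⊕₁ ([]-cong₂ assoc assoc)

  ⊕₁-id : ∀ {A B} → id {A} ⊕₁ id {B} ≡ id
  ⊕₁-id = trans ([]-cong₂ identityʳ identityʳ)
                (sym (IsCoproduct.unique isCoproduct id identityˡ identityˡ))

  ⊕₁-splitˡ : f ⊕₁ g ≡ (id ⊕₁ g) ∘ (f ⊕₁ id)
  ⊕₁-splitˡ = sym (trans ⊕₁∘⊕₁ (cong₂ _⊕₁_ identityˡ identityʳ))

  ⊕₁-splitʳ : f ⊕₁ g ≡ (f ⊕₁ id) ∘ (id ⊕₁ g)
  ⊕₁-splitʳ = sym (trans ⊕₁∘⊕₁ (cong₂ _⊕₁_ identityʳ identityˡ))

  ⊕₁-swap : (f ⊕₁ id) ∘ (id ⊕₁ g) ≡ (id ⊕₁ g) ∘ (f ⊕₁ id)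
  ⊕₁-swap = trans (sym ⊕₁-splitʳ) ⊕₁-splitˡ

  ⊕₁id∘⊕₁id : ∀ {A} → (f ⊕₁ id {A}) ∘ (g ⊕₁ id) ≡ (f ∘ g) ⊕₁ id
  ⊕₁id∘⊕₁id = trans ⊕₁∘⊕₁ (cong₂ _⊕₁_ refl identityˡ)

module ProductCoproductLaws {o h} {C : Category o h}
                        (P : BinaryProducts C) (S : BinaryCoproducts C) where
  open Category C
  open BinaryProducts P
  open BinaryCoproducts S
  open ProductLaws P
  open CoproductLaws S

  ⟨[],[]⟩ : ∀ {A B D E} {a : Hom A D} {b : Hom B D} {c : Hom A E} {d : Hom B E} →
           ⟨ [ a , b ] , [ c , d ] ⟩ ≡ [ ⟨ a , c ⟩ , ⟨ b , d ⟩ ]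
  ⟨[],[]⟩ = IsCoproduct.unique isCoproduct _ (trans ⟨⟩∘ (⟨⟩-cong₂ inject₁ inject₁))
                                            (trans ⟨⟩∘ (⟨⟩-cong₂ inject₂ inject₂))

  project₁⊕₁ : ∀ {A B D E Z} {a : Hom Z A} {b : Hom Z B} {d : Hom D E} →
               (π₁ ⊕₁ id) ∘ (⟨ a , b ⟩ ⊕₁ d) ≡ a ⊕₁ d
  project₁⊕₁ = trans ⊕₁∘⊕₁ (cong₂ _⊕₁_ project₁ identityˡ)

  project₂⊕₁ : ∀ {A B D E Z} {a : Hom Z A} {b : Hom Z B} {d : Hom D E} →
               (π₂ ⊕₁ id) ∘ (⟨ a , b ⟩ ⊕₁ d) ≡ b ⊕₁ d
  project₂⊕₁ = trans ⊕₁∘⊕₁ (cong₂ _⊕₁_ project₂ identityˡ)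

-- (X × B , π₁) is B pulled back along X → 1: iterate in the B component, keep the X component.
module ConstantFamily {o h} {C : Category o h} (P : BinaryProducts C) (S : BinaryCoproducts C)
                      {B : Category.Obj C} (β : UIAlg C S B) where
  open Category C
  open BinaryProducts P
  open BinaryCoproducts S
  open UIAlg β
  open CategoryLaws C
  open ProductLaws P
  open CoproductLaws S

  constantSliceAlg : ∀ {X} → SliceUIAlg C S (π₁ {X} {B})
  constantSliceAlg = record
    { dagger = λ {_} {r} f _ → ⟨ r , ((π₂ ⊕₁ id) ∘ f) † ⟩
    ; over = project₁
    ; fixpoint = λ {_} {r} {f} {e} → unfold r f e
    ; uniformity = λ {_} {_} {r} {s} {f} {g} k sk commute → shift r s f g k sk commute
    }
    where
    unfold : ∀ {X Z} (r : Hom Z X) (f : Hom Z ((X ⊗ B) ⊕ Z)) → [ π₁ , r ] ∘ f ≡ r →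
             ⟨ r , ((π₂ ⊕₁ id) ∘ f) † ⟩ ≡ [ id , ⟨ r , ((π₂ ⊕₁ id) ∘ f) † ⟩ ] ∘ f
    unfold r f e = sym (trans (sym ⟨⟩-η) (⟨⟩-cong₂ first second))
      where
      first = trans (pullˡ (trans ∘[] ([]-cong₂ identityʳ project₁))) e
      second = trans (pullˡ (trans ∘[] ([]-cong₂ identityʳ project₂)))
                     (sym (trans fixpoint (pullˡ (trans []∘⊕₁ ([]-cong₂ identityˡ identityʳ)))))
    shift : ∀ {X Z W} (r : Hom Z X) (s : Hom W X) (f : Hom Z ((X ⊗ B) ⊕ Z))
            (g : Hom W ((X ⊗ B) ⊕ W)) (k : Hom Z W) → s ∘ k ≡ r →
            (id ⊕₁ k) ∘ f ≡ g ∘ k →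
            ⟨ r , ((π₂ ⊕₁ id) ∘ f) † ⟩ ≡ ⟨ s , ((π₂ ⊕₁ id) ∘ g) † ⟩ ∘ k
    shift r s f g k sk commute =
      trans (⟨⟩-cong₂ (sym sk) (uniformity k (trans (pullˡ (sym ⊕₁-swap))
                                                    (trans (pullʳ commute) (sym assoc)))))
            (sym ⟨⟩∘)

module Iteration {o h} (𝒮 : Setting o h) where
  open Setting 𝒮
  open Category C
  open BinaryProducts products
  open BinaryCoproducts coproducts
  open CategoryLaws C
  open ProductLaws products
  open CoproductLaws coproducts
  open ProductCoproductLaws products coproducts
  open ConstantFamily products coproducts using (constantSliceAlg)
  open ≡-Reasoning

  private variable
    A B D P Q X Y Z : Obj

  dstr-inl : dstr {X} {A} {B} ∘ (id ⊗₁ inl) ≡ inl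
  dstr-inl = trans (∘-congʳ (sym inject₁)) (trans (pullˡ dstr-inverseʳ) identityˡ)

  dstr-inr : dstr {X} {A} {B} ∘ (id ⊗₁ inr) ≡ inr
  dstr-inr = trans (∘-congʳ (sym inject₂)) (trans (pullˡ dstr-inverseʳ) identityˡ)

  dstr-universal : (p : Hom (D ⊗ (A ⊕ B)) Q) →
                   [ p ∘ (id ⊗₁ inl) , p ∘ (id ⊗₁ inr) ] ∘ dstr ≡ p
  dstr-universal p = trans (∘-congˡ (sym ∘[])) (trans (pullʳ dstr-inverseˡ) identityʳ)

  [π₁,π₁]∘dstr : [ π₁ , π₁ ] ∘ dstr {D} {A} {B} ≡ π₁
  [π₁,π₁]∘dstr = trans (∘-congˡ ([]-cong₂ (sym π₁∘id⊗₁) (sym π₁∘id⊗₁))) (dstr-universal π₁)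

  π₂⊕₁π₂∘dstr : (π₂ ⊕₁ π₂) ∘ dstr {D} {A} {B} ≡ π₂
  π₂⊕₁π₂∘dstr = trans (∘-congˡ ([]-cong₂ (sym project₂) (sym project₂))) (dstr-universal π₂)

  id⊗₁[] : ∀ {a : Hom A Q} {b : Hom B Q} →
           id {D} ⊗₁ [ a , b ] ≡ [ id ⊗₁ a , id ⊗₁ b ] ∘ dstr
  id⊗₁[] {a = a} {b} = sym (trans (∘-congˡ ([]-cong₂ (at inject₁) (at inject₂))) (dstr-universal _))
    where
    at : ∀ {E} {i : Hom E _} {c : Hom E _} → [ a , b ] ∘ i ≡ c →
         id ⊗₁ c ≡ (id ⊗₁ [ a , b ]) ∘ (id {D} ⊗₁ i)
    at e = sym (trans ⊗₁∘⊗₁ (cong₂ _⊗₁_ identityˡ e))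

  dstr∘⟨[],⊕₁⟩ : ∀ {a : Hom A D} {b : Hom B D} {c : Hom A Q} {d : Hom B Z} →
                 dstr ∘ ⟨ [ a , b ] , c ⊕₁ d ⟩ ≡ ⟨ a , c ⟩ ⊕₁ ⟨ b , d ⟩
  dstr∘⟨[],⊕₁⟩ = trans (∘-congʳ ⟨[],[]⟩) (trans ∘[] ([]-cong₂ (at dstr-inl) (at dstr-inr)))
    where
    at : ∀ {E E₁ E₂} {a : Hom Z D} {c : Hom Z E} {i : Hom E (E₁ ⊕ E₂)}
           {j : Hom (D ⊗ E) ((D ⊗ E₁) ⊕ (D ⊗ E₂))} →
         dstr ∘ (id ⊗₁ i) ≡ j → dstr ∘ ⟨ a , i ∘ c ⟩ ≡ j ∘ ⟨ a , c ⟩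
    at e = trans (∘-congʳ (sym id⊗₁∘⟨⟩)) (pullˡ e)

  π₁⊕₁id∘dstr∘⟨[],⊕₁⟩ : ∀ {a : Hom A D} {b : Hom B D} {c : Hom A Q} {d : Hom B Z} →
                        (π₁ ⊕₁ id) ∘ dstr ∘ ⟨ [ a , b ] , c ⊕₁ d ⟩ ≡ a ⊕₁ ⟨ b , d ⟩
  π₁⊕₁id∘dstr∘⟨[],⊕₁⟩ = trans (∘-congʳ dstr∘⟨[],⊕₁⟩) project₁⊕₁

  algK : ∀ X → UIAlg C coproducts (K X)
  algK X = FreeUIAlg.alg (free X)

  †-fixpoint : ∀ {f : Hom Z (K Y ⊕ Z)} → f † ≡ [ id , f † ] ∘ f
  †-fixpoint {Y = Y} = UIAlg.fixpoint (algK Y)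

  †-uniform : ∀ {f : Hom Z (K Y ⊕ Z)} {g : Hom D (K Y ⊕ D)} (k : Hom Z D) →
              (id ⊕₁ k) ∘ f ≡ g ∘ k → f † ≡ g † ∘ k
  †-uniform {Y = Y} = UIAlg.uniformity (algK Y)

  *-η : (f : Hom X (K Y)) → f * ∘ η ≡ f
  *-η {X} {Y} = FreeUIAlg.lift-η (free X) (algK Y)

  *-isMorphism : (f : Hom X (K Y)) → IsUIMorphism C coproducts (algK X) (algK Y) (f *)
  *-isMorphism {X} {Y} = FreeUIAlg.lift-morphism (free X) (algK Y)

  id-isMorphism : IsUIMorphism C coproducts (algK X) (algK X) id
  id-isMorphism f = trans identityˡ (cong _† (sym (trans (∘-congˡ ⊕₁-id) identityˡ)))

  K-morphism-ext : (β : UIAlg C coproducts B) {k k' : Hom (K X) B} →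
                   IsUIMorphism C coproducts (algK X) β k →
                   IsUIMorphism C coproducts (algK X) β k' →
                   k ∘ η ≡ k' ∘ η → k ≡ k'
  K-morphism-ext {X = X} β {k} {k'} mk mk' e =
    trans (lift-unique β (k' ∘ η) k mk e) (sym (lift-unique β (k' ∘ η) k' mk' refl))
    where open FreeUIAlg (free X) using (lift-unique)

  -- Equivalently, ⟨ π₁ , m ⟩ is a morphism over P out of the algebra of the stability axiom.
  IsStableMorphism : UIAlg C coproducts B → Hom (P ⊗ K Y) B → Set (o ⊔ h)
  IsStableMorphism {P = P} {Y = Y} β m =
    ∀ {Z} (ρ : Hom Z P) (f : Hom Z ((P ⊗ K Y) ⊕ Z)) → [ π₁ , ρ ] ∘ f ≡ ρ →
    m ∘ stableDagger C coproducts products (free Y) ρ f ≡ UIAlg._† β ((m ⊕₁ id) ∘ f)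

  stable-morphism-unique : (β : UIAlg C coproducts B) {m m' : Hom (P ⊗ K Y) B} →
                           IsStableMorphism β m → IsStableMorphism β m' →
                           m ∘ (id ⊗₁ η) ≡ m' ∘ (id ⊗₁ η) → m ≡ m'
  stable-morphism-unique {Y = Y} β {m} {m'} sm sm' e = begin
      m                  ≡⟨ sym project₂ ⟩
      π₂ ∘ ⟨ π₁ , m ⟩    ≡⟨ ∘-congʳ (trans (as-slift sm refl) (sym (as-slift sm' onη))) ⟩
      π₂ ∘ ⟨ π₁ , m' ⟩   ≡⟨ project₂ ⟩
      m'                 ∎
    where
    open Stable (stable Y) using (slift; slift-unique)
    gen = ⟨ π₁ , m ⟩ ∘ (id ⊗₁ η)
    over : π₁ ∘ gen ≡ π₁
    over = trans (pullˡ project₁) π₁∘id⊗₁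
    onη : ⟨ π₁ , m' ⟩ ∘ (id ⊗₁ η) ≡ gen
    onη = trans ⟨⟩∘ (trans (⟨⟩-cong₂ refl (sym e)) (sym ⟨⟩∘))
    as-slift : ∀ {n} → IsStableMorphism β n → ⟨ π₁ , n ⟩ ∘ (id ⊗₁ η) ≡ gen →
               ⟨ π₁ , n ⟩ ≡ slift (constantSliceAlg β) gen over
    as-slift sn = slift-unique (constantSliceAlg β) gen over _ project₁ λ f e₁ _ →
      trans ⟨⟩∘ (⟨⟩-cong₂ project₁
        (trans (sn _ f e₁) (cong (UIAlg._† β) (sym (pullˡ project₂⊕₁)))))

  π₂-isStable : IsStableMorphism (algK Y) (π₂ {P})
  π₂-isStable _ _ _ = project₂

  ∘-isStable : {β : UIAlg C coproducts A} {γ : UIAlg C coproducts B}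
               {m : Hom (P ⊗ K Y) A} {k : Hom A B} →
               IsStableMorphism β m → IsUIMorphism C coproducts β γ k →
               IsStableMorphism γ (k ∘ m)
  ∘-isStable {γ = γ} sm mk ρ f e =
    trans (pullʳ (sm ρ f e)) (trans (mk _) (cong (UIAlg._† γ) (pullˡ ⊕₁id∘⊕₁id)))

  τ-isStable : IsStableMorphism (algK (P ⊗ Y)) (τ {P} {Y})
  τ-isStable ρ f e = begin
      τ ∘ ⟨ ρ , Kf † ⟩                              ≡⟨ ∘-congʳ (sym id⊗₁∘⟨ ρ ,id⟩) ⟩
      τ ∘ (id ⊗₁ Kf †) ∘ ⟨ ρ , id ⟩                 ≡⟨ pullˡ (τ-† Kf) ⟩
      ((τ ⊕₁ id) ∘ dstr ∘ (id ⊗₁ Kf)) † ∘ ⟨ ρ , id ⟩ ≡⟨ sym (†-uniform ⟨ ρ , id ⟩ (sym body)) ⟩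
      ((τ ⊕₁ id) ∘ f) †                               ∎
    where
    Kf = (π₂ ⊕₁ id) ∘ f
    body : ((τ ⊕₁ id) ∘ dstr ∘ (id ⊗₁ Kf)) ∘ ⟨ ρ , id ⟩ ≡ (id ⊕₁ ⟨ ρ , id ⟩) ∘ (τ ⊕₁ id) ∘ f
    body = begin
        ((τ ⊕₁ id) ∘ dstr ∘ (id ⊗₁ Kf)) ∘ ⟨ ρ , id ⟩
          ≡⟨ pullʳ (pullʳ (trans id⊗₁∘⟨⟩ (⟨⟩-cong₂ (sym e) identityʳ))) ⟩
        (τ ⊕₁ id) ∘ dstr ∘ ⟨ [ π₁ , ρ ] ∘ f , (π₂ ⊕₁ id) ∘ f ⟩
          ≡⟨ ∘-congʳ (∘-congʳ (sym ⟨⟩∘)) ⟩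
        (τ ⊕₁ id) ∘ dstr ∘ ⟨ [ π₁ , ρ ] , π₂ ⊕₁ id ⟩ ∘ f
          ≡⟨ ∘-congʳ (pullˡ (trans dstr∘⟨[],⊕₁⟩ (cong (_⊕₁ ⟨ ρ , id ⟩) ⟨π₁,π₂⟩))) ⟩
        (τ ⊕₁ id) ∘ (id ⊕₁ ⟨ ρ , id ⟩) ∘ f
          ≡⟨ trans (pullˡ ⊕₁-swap) assoc ⟩
        (id ⊕₁ ⟨ ρ , id ⟩) ∘ (τ ⊕₁ id) ∘ f
          ∎

  ⟨⟩-isStable : {β : UIAlg C coproducts B} {n : Hom (Q ⊗ K Y) B} (u : Hom P Q)
                {m : Hom (P ⊗ K Y) (K Y)} →
                IsStableMorphism β n → IsStableMorphism (algK Y) m →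
                IsStableMorphism β (n ∘ ⟨ u ∘ π₁ , m ⟩)
  ⟨⟩-isStable {β = β} {n} u {m} sn sm ρ f e = begin
      (n ∘ ⟨ u ∘ π₁ , m ⟩) ∘ ⟨ ρ , ((π₂ ⊕₁ id) ∘ f) † ⟩
        ≡⟨ pullʳ (trans ⟨⟩∘ (⟨⟩-cong₂ (pullʳ project₁) (sm ρ f e))) ⟩
      n ∘ ⟨ u ∘ ρ , ((m ⊕₁ id) ∘ f) † ⟩
        ≡⟨ ∘-congʳ (⟨⟩-cong₂ refl (cong _† (sym (pullˡ project₂⊕₁)))) ⟩
      n ∘ ⟨ u ∘ ρ , ((π₂ ⊕₁ id) ∘ f′) † ⟩
        ≡⟨ sn (u ∘ ρ) f′ over ⟩
      UIAlg._† β ((n ⊕₁ id) ∘ f′)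
        ≡⟨ cong (UIAlg._† β) (pullˡ ⊕₁id∘⊕₁id) ⟩
      UIAlg._† β (((n ∘ ⟨ u ∘ π₁ , m ⟩) ⊕₁ id) ∘ f)
        ∎
    where
    f′ = (⟨ u ∘ π₁ , m ⟩ ⊕₁ id) ∘ f
    over : [ π₁ , u ∘ ρ ] ∘ f′ ≡ u ∘ ρ
    over = trans (pullˡ (trans []∘⊕₁ (trans ([]-cong₂ project₁ identityʳ) (sym ∘[])))) (pullʳ e)

  restrict : Hom (K Y ⊗ K Y) (K Y)
  restrict {Y} = π₁ {K Y} {Y} * ∘ τ

  ⇂-restrict : {f g : Hom X (K Y)} → f ⇂ g ≡ restrict ∘ ⟨ f , g ⟩
  ⇂-restrict = sym assoc

  restrict-isStable : IsStableMorphism (algK Y) (restrict {Y})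
  restrict-isStable {Y} = ∘-isStable {β = algK (K Y ⊗ Y)} {γ = algK Y} τ-isStable (*-isMorphism π₁)

  restrict-η : {u : Hom Z (K Y)} {v : Hom Z Y} → restrict ∘ ⟨ u , η ∘ v ⟩ ≡ u
  restrict-η {u = u} {v} = begin
    restrict ∘ ⟨ u , η ∘ v ⟩          ≡⟨ ∘-congʳ (sym id⊗₁∘⟨⟩) ⟩
    restrict ∘ (id ⊗₁ η) ∘ ⟨ u , v ⟩ ≡⟨ pullʳ (pullˡ τ-η) ⟩
    π₁ * ∘ η ∘ ⟨ u , v ⟩             ≡⟨ pullˡ (*-η π₁) ⟩
    π₁ ∘ ⟨ u , v ⟩                   ≡⟨ project₁ ⟩
    u                                ∎

  restrict∘Δ-isMorphism : IsUIMorphism C coproducts (algK Y) (algK Y) (restrict ∘ ⟨ id , id ⟩)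
  restrict∘Δ-isMorphism f = begin
      (restrict ∘ ⟨ id , id ⟩) ∘ f †
        ≡⟨ pullʳ (trans ⟨⟩∘ (⟨⟩-cong₂ identityˡ identityˡ)) ⟩
      restrict ∘ ⟨ f † , f † ⟩
        ≡⟨ ∘-congʳ (⟨⟩-cong₂ refl (cong _† (sym unpair))) ⟩
      restrict ∘ ⟨ f † , ((π₂ ⊕₁ id) ∘ f′) † ⟩
        ≡⟨ restrict-isStable (f †) f′ over ⟩
      ((restrict ⊕₁ id) ∘ f′) †
        ≡⟨ cong _† (pullˡ ⊕₁id∘⊕₁id) ⟩
      (((restrict ∘ ⟨ id , id ⟩) ⊕₁ id) ∘ f) †
        ∎
    where
    f′ = (⟨ id , id ⟩ ⊕₁ id) ∘ f
    unpair : (π₂ ⊕₁ id) ∘ f′ ≡ f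
    unpair = trans (pullˡ (trans project₂⊕₁ ⊕₁-id)) identityˡ
    over : [ π₁ , f † ] ∘ f′ ≡ f †
    over = trans (pullˡ (trans []∘⊕₁ ([]-cong₂ project₁ identityʳ))) (sym †-fixpoint)

  restrict∘Δ : restrict ∘ ⟨ id , id ⟩ ≡ id {K Y}
  restrict∘Δ {Y} = K-morphism-ext (algK Y) restrict∘Δ-isMorphism id-isMorphism
    (trans (pullʳ (trans ⟨⟩∘ (⟨⟩-cong₂ identityˡ (trans identityˡ (sym identityʳ)))))
           (trans restrict-η (sym identityˡ)))

  restrict-idem : (x : Hom Z (K Y)) → restrict ∘ ⟨ x , x ⟩ ≡ x
  restrict-idem x = trans (∘-congʳ (sym (trans ⟨⟩∘ (⟨⟩-cong₂ identityˡ identityˡ))))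
                          (trans (pullˡ restrict∘Δ) identityˡ)

  -- Both sides are stable in the last argument and agree on η, where they reduce to restrict ∘ π₁.
  restrict-assoc-generic :
    restrict ∘ ⟨ restrict ∘ π₁ , π₂ ⟩ ≡ restrict {Y} ∘ ⟨ π₁ ∘ π₁ , restrict ∘ ⟨ π₂ ∘ π₁ , π₂ ⟩ ⟩
  restrict-assoc-generic {Y} = stable-morphism-unique (algK Y)
    (⟨⟩-isStable {β = algK Y} restrict restrict-isStable π₂-isStable)
    (⟨⟩-isStable {β = algK Y} π₁ restrict-isStable
      (⟨⟩-isStable {β = algK Y} π₂ restrict-isStable π₂-isStable))
    (trans left (sym right))
    where
    pair∘id⊗₁η : ∀ {A B D} {u : Hom A D} {m : Hom (A ⊗ K Y) B} →
                 ⟨ u ∘ π₁ , m ⟩ ∘ (id ⊗₁ η) ≡ ⟨ u ∘ π₁ , m ∘ (id ⊗₁ η) ⟩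
    pair∘id⊗₁η = trans ⟨⟩∘ (⟨⟩-cong₂ (pullʳ π₁∘id⊗₁) refl)

    left : (restrict ∘ ⟨ restrict ∘ π₁ , π₂ ⟩) ∘ (id ⊗₁ η) ≡ restrict ∘ π₁
    left = begin
      (restrict ∘ ⟨ restrict ∘ π₁ , π₂ ⟩) ∘ (id ⊗₁ η)
        ≡⟨ pullʳ (trans pair∘id⊗₁η (⟨⟩-cong₂ refl project₂)) ⟩
      restrict ∘ ⟨ restrict ∘ π₁ , η ∘ π₂ ⟩
        ≡⟨ restrict-η ⟩
      restrict ∘ π₁
        ∎

    right : (restrict ∘ ⟨ π₁ ∘ π₁ , restrict ∘ ⟨ π₂ ∘ π₁ , π₂ ⟩ ⟩) ∘ (id ⊗₁ η) ≡ restrict ∘ π₁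
    right = begin
      (restrict ∘ ⟨ π₁ ∘ π₁ , restrict ∘ ⟨ π₂ ∘ π₁ , π₂ ⟩ ⟩) ∘ (id ⊗₁ η)
        ≡⟨ pullʳ (trans pair∘id⊗₁η (⟨⟩-cong₂ refl (pullʳ (trans pair∘id⊗₁η (⟨⟩-cong₂ refl project₂))))) ⟩
      restrict ∘ ⟨ π₁ ∘ π₁ , restrict ∘ ⟨ π₂ ∘ π₁ , η ∘ π₂ ⟩ ⟩
        ≡⟨ ∘-congʳ (⟨⟩-cong₂ refl restrict-η) ⟩
      restrict ∘ ⟨ π₁ ∘ π₁ , π₂ ∘ π₁ ⟩
        ≡⟨ ∘-congʳ (trans (sym ⟨⟩∘) (trans (∘-congˡ ⟨π₁,π₂⟩) identityˡ)) ⟩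
      restrict ∘ π₁
        ∎

  restrict-assoc : (p q s : Hom Z (K Y)) →
                   restrict ∘ ⟨ restrict ∘ ⟨ p , q ⟩ , s ⟩ ≡ restrict ∘ ⟨ p , restrict ∘ ⟨ q , s ⟩ ⟩
  restrict-assoc p q s = begin
      restrict ∘ ⟨ restrict ∘ ⟨ p , q ⟩ , s ⟩
        ≡⟨ sym (pullʳ (trans ⟨⟩∘ (⟨⟩-cong₂ (pullʳ project₁) project₂))) ⟩
      (restrict ∘ ⟨ restrict ∘ π₁ , π₂ ⟩) ∘ ⟨ ⟨ p , q ⟩ , s ⟩
        ≡⟨ ∘-congˡ restrict-assoc-generic ⟩
      (restrict ∘ ⟨ π₁ ∘ π₁ , restrict ∘ ⟨ π₂ ∘ π₁ , π₂ ⟩ ⟩) ∘ ⟨ ⟨ p , q ⟩ , s ⟩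
        ≡⟨ pullʳ (trans ⟨⟩∘ (⟨⟩-cong₂ (trans (pullʳ project₁) project₁)
             (pullʳ (trans ⟨⟩∘ (⟨⟩-cong₂ (trans (pullʳ project₁) project₂) project₂))))) ⟩
      restrict ∘ ⟨ p , restrict ∘ ⟨ q , s ⟩ ⟩
        ∎

  ⊑-refl : {u : Hom X (K Y)} → u ⊑ u
  ⊑-refl {u = u} = sym (trans ⇂-restrict (restrict-idem u))

  †-prefixpoint : (f : Hom X (K Y ⊕ X)) → [ id , f † ] ∘ f ⊑ f †
  †-prefixpoint f = trans (sym †-fixpoint) (trans ⊑-refl (cong (f † ⇂_) †-fixpoint))

  restrict-† : (f : Hom X (K Y ⊕ X)) →
               ((restrict ⊕₁ id) ∘ dstr ∘ (id ⊗₁ f)) † ≡ restrict ∘ (id ⊗₁ f †)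
  restrict-† f = begin
      ((restrict ⊕₁ id) ∘ E) †
        ≡⟨ sym (restrict-isStable π₁ E over) ⟩
      restrict ∘ ⟨ π₁ , ((π₂ ⊕₁ id) ∘ E) † ⟩
        ≡⟨ ∘-congʳ (⟨⟩-cong₂ (sym identityˡ) (†-uniform π₂ body)) ⟩
      restrict ∘ (id ⊗₁ f †)
        ∎
    where
    E = dstr ∘ (id ⊗₁ f)
    over : [ π₁ , π₁ ] ∘ E ≡ π₁
    over = trans (pullˡ [π₁,π₁]∘dstr) π₁∘id⊗₁
    body : (id ⊕₁ π₂) ∘ (π₂ ⊕₁ id) ∘ E ≡ f ∘ π₂
    body = trans (pullˡ (sym ⊕₁-splitˡ)) (trans (pullˡ π₂⊕₁π₂∘dstr) project₂)

  module Leastness (f : Hom X (K Y ⊕ X)) (g : Hom X (K Y)) (prefix : [ id , g ] ∘ f ⊑ g) where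
    G : Hom X (K Y)
    G = [ id , g ] ∘ f

    G-restricted : restrict ∘ ⟨ g , G ⟩ ≡ G
    G-restricted = sym (trans prefix ⇂-restrict)

    F : Hom (K Y ⊗ X) (K Y ⊕ (K Y ⊗ X))
    F = (restrict ⊕₁ id) ∘ dstr ∘ (id ⊗₁ f)

    k : Hom (K Y ⊗ X) (K Y ⊗ X)
    k = ⟨ restrict ∘ (id ⊗₁ g) , π₂ ⟩

    H : Hom (K Y ⊗ X) (K Y ⊕ (K Y ⊗ X))
    H = (π₁ ⊕₁ id) ∘ dstr ∘ ⟨ restrict ∘ (id ⊗₁ G) , f ∘ π₂ ⟩

    H∘_ : (x : Hom Z (K Y ⊗ X)) →
          H ∘ x ≡ (π₁ ⊕₁ id) ∘ dstr ∘ ⟨ (restrict ∘ (id ⊗₁ G)) ∘ x , (f ∘ π₂) ∘ x ⟩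
    H∘ x = pullʳ (pullʳ ⟨⟩∘)

    restrict∘id⊗₁G : restrict ∘ (id ⊗₁ G) ≡ [ restrict , restrict ∘ (id ⊗₁ g) ] ∘ dstr ∘ (id ⊗₁ f)
    restrict∘id⊗₁G = begin
      restrict ∘ (id ⊗₁ G)
        ≡⟨ ∘-congʳ (sym (trans ⊗₁∘⊗₁ (cong (_⊗₁ G) identityˡ))) ⟩
      restrict ∘ (id ⊗₁ [ id , g ]) ∘ (id ⊗₁ f)
        ≡⟨ ∘-congʳ (trans (∘-congˡ id⊗₁[]) assoc) ⟩
      restrict ∘ [ id ⊗₁ id , id ⊗₁ g ] ∘ dstr ∘ (id ⊗₁ f)
        ≡⟨ pullˡ (trans ∘[] ([]-cong₂ (trans (∘-congʳ ⊗₁-id) identityʳ) refl)) ⟩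
      [ restrict , restrict ∘ (id ⊗₁ g) ] ∘ dstr ∘ (id ⊗₁ f)
        ∎

    H≡k∘F : H ≡ (id ⊕₁ k) ∘ F
    H≡k∘F = begin
      (π₁ ⊕₁ id) ∘ dstr ∘ ⟨ restrict ∘ (id ⊗₁ G) , f ∘ π₂ ⟩
        ≡⟨ ∘-congʳ (∘-congʳ (trans (⟨⟩-cong₂ restrict∘id⊗₁G f∘π₂≡) (sym ⟨⟩∘))) ⟩
      (π₁ ⊕₁ id) ∘ dstr ∘ ⟨ [ restrict , restrict ∘ (id ⊗₁ g) ] , π₂ ⊕₁ π₂ ⟩ ∘ dstr ∘ (id ⊗₁ f)
        ≡⟨ trans (∘-congʳ (sym assoc)) (pullˡ π₁⊕₁id∘dstr∘⟨[],⊕₁⟩) ⟩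
      (restrict ⊕₁ k) ∘ dstr ∘ (id ⊗₁ f)
        ≡⟨ trans (∘-congˡ ⊕₁-splitˡ) assoc ⟩
      (id ⊕₁ k) ∘ F
        ∎
      where
      f∘π₂≡ : f ∘ π₂ ≡ (π₂ ⊕₁ π₂) ∘ dstr ∘ (id ⊗₁ f)
      f∘π₂≡ = sym (trans (pullˡ π₂⊕₁π₂∘dstr) project₂)

    -- Associativity of ⇂ together with G = g ⇂ G.
    H∘k : H ∘ k ≡ H
    H∘k = trans (H∘ k) (∘-congʳ (∘-congʳ (⟨⟩-cong₂ absorb (pullʳ project₂))))
      where
      absorb : (restrict ∘ (id ⊗₁ G)) ∘ k ≡ restrict ∘ (id ⊗₁ G)
      absorb = begin
        (restrict ∘ (id ⊗₁ G)) ∘ k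
          ≡⟨ pullʳ id⊗₁∘⟨⟩ ⟩
        restrict ∘ ⟨ restrict ∘ (id ⊗₁ g) , G ∘ π₂ ⟩
          ≡⟨ restrict-assoc (id ∘ π₁) (g ∘ π₂) (G ∘ π₂) ⟩
        restrict ∘ ⟨ id ∘ π₁ , restrict ∘ ⟨ g ∘ π₂ , G ∘ π₂ ⟩ ⟩
          ≡⟨ ∘-congʳ (⟨⟩-cong₂ refl (trans (∘-congʳ (sym ⟨⟩∘)) (pullˡ G-restricted))) ⟩
        restrict ∘ (id ⊗₁ G)
          ∎

    H∘⟨g,id⟩ : H ∘ ⟨ g , id ⟩ ≡ (id ⊕₁ ⟨ g , id ⟩) ∘ f
    H∘⟨g,id⟩ = begin
      H ∘ ⟨ g , id ⟩
        ≡⟨ H∘ ⟨ g , id ⟩ ⟩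
      (π₁ ⊕₁ id) ∘ dstr ∘ ⟨ (restrict ∘ (id ⊗₁ G)) ∘ ⟨ g , id ⟩ , (f ∘ π₂) ∘ ⟨ g , id ⟩ ⟩
        ≡⟨ ∘-congʳ (∘-congʳ (⟨⟩-cong₂ (trans (pullʳ id⊗₁∘⟨ g ,id⟩) G-restricted)
                                       (trans (pullʳ project₂) identityʳ))) ⟩
      (π₁ ⊕₁ id) ∘ dstr ∘ ⟨ [ id , g ] ∘ f , f ⟩
        ≡⟨ ∘-congʳ (∘-congʳ (trans (⟨⟩-cong₂ refl (sym (trans (∘-congˡ ⊕₁-id) identityˡ))) (sym ⟨⟩∘))) ⟩
      (π₁ ⊕₁ id) ∘ dstr ∘ ⟨ [ id , g ] , id ⊕₁ id ⟩ ∘ f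
        ≡⟨ trans (∘-congʳ (sym assoc)) (pullˡ π₁⊕₁id∘dstr∘⟨[],⊕₁⟩) ⟩
      (id ⊕₁ ⟨ g , id ⟩) ∘ f
        ∎

    k∘⟨g,id⟩ : k ∘ ⟨ g , id ⟩ ≡ ⟨ g , id ⟩
    k∘⟨g,id⟩ = trans ⟨⟩∘ (⟨⟩-cong₂ (trans (pullʳ id⊗₁∘⟨ g ,id⟩) (restrict-idem g)) project₂)

    H†∘k : H † ∘ k ≡ F †
    H†∘k = sym (†-uniform k (trans (sym H≡k∘F) (sym H∘k)))

    †-least : f † ⊑ g
    †-least = begin
      f †                                    ≡⟨ †-uniform ⟨ g , id ⟩ (sym H∘⟨g,id⟩) ⟩
      H † ∘ ⟨ g , id ⟩                       ≡⟨ ∘-congʳ (sym k∘⟨g,id⟩) ⟩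
      H † ∘ k ∘ ⟨ g , id ⟩                   ≡⟨ pullˡ H†∘k ⟩
      F † ∘ ⟨ g , id ⟩                       ≡⟨ ∘-congˡ (restrict-† f) ⟩
      (restrict ∘ (id ⊗₁ f †)) ∘ ⟨ g , id ⟩  ≡⟨ pullʳ id⊗₁∘⟨ g ,id⟩ ⟩
      restrict ∘ ⟨ g , f † ⟩                 ≡⟨ sym ⇂-restrict ⟩
      g ⇂ f †                                ∎

corollary5p16 : ∀ {o h} (𝒮 : Setting o h) →
    let open Setting 𝒮
        open Category C
        open BinaryCoproducts coproducts
    in ∀ {X Y : Obj} (f : Hom X (K Y ⊕ X)) →
       ([ id , f † ] ∘ f ⊑ f †)
       × (∀ (g : Hom X (K Y)) → [ id , g ] ∘ f ⊑ g → f † ⊑ g)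
corollary5p16 𝒮 f = †-prefixpoint f , λ g prefix → Leastness.†-least f g prefix
  where open Iteration 𝒮
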